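{- Let $m \ge 2$, $r$, and $t$ be positive integers and let $\mathcal{H}$ be a set of connected $m$-uniform hypergraphs each having more than $t$ vertices. If there exists an $m$-$(r,t,1)$ design, then \[ f_m(r, \mathcal{H}) \leq \binom{r-1}{m-1} \Big/ \binom{t-1}{m-1}. \]
   Context: An $m$-$(r,t,\lambda)$ design is a collection of $t$-element subsets (blocks) of an $r$-element point set such that every $m$-element set of points is contained in exactly $\lambda$ blocks. An $m$-uniform hypergraph $G$ is an $(r,k)$-hypergraph if $V(G)$ can be partitioned into sets $V_1,\dots,V_r$ with $|V_i| \le k$ for all $i$ such that for every $m$-element subset $\{i_1,\dots,i_m\}$ of $[r]$ there is an edge $e \in E(G)$ with $|e \cap V_{i_j}| = 1$ for $1 \le j \le m$. For a family $\mathcal{H}$ of $m$-uniform hypergraphs, $f_m(r,\mathcal{H})$ is the minimum $k$ such that there exists an $m$-uniform $(r,k)$-hypergraph containing no member of $\mathcal{H}$ as a subgraph. -}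

module Defs where

open import Data.Nat using (ℕ; zero; suc; _≤_; _<_; _*_; _∸_)
open import Data.Nat.Combinatorics using (_C_)
open import Data.Fin using (Fin; _≟_)
open import Data.Fin.Subset using (Subset; _∈_; _⊆_; _∩_; ∣_∣)
open import Data.Fin.Subset.Properties using (_∈?_; _⊆?_)
open import Data.Fin.Properties using (any?)
open import Data.Vec using (tabulate)
open import Data.List using (List; length; filter)
open import Data.List.Relation.Unary.All using (All)
import Data.List.Membership.Propositional as LM
open import Data.Product using (Σ; _×_; ∃)
open import Relation.Nullary using (¬_; does)
open import Relation.Nullary.Decidable using (_×-dec_)
open import Function.Definitions using (Injective)
open import Relation.Binary.PropositionalEquality using (_≡_)

record Hypergraph (m : ℕ) : Set where
  constructor hypergraph
  field
    nV      : ℕ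
    edges   : List (Subset nV)
    uniform : All (λ e → ∣ e ∣ ≡ m) edges
open Hypergraph public

image : ∀ {a b} → (Fin a → Fin b) → Subset a → Subset b
image {a} φ e = tabulate (λ j → does (any? (λ i → (i ∈? e) ×-dec (φ i ≟ j))))

_⊑_ : ∀ {m} → Hypergraph m → Hypergraph m → Set
H ⊑ G = Σ (Fin (nV H) → Fin (nV G)) λ φ →
          Injective _≡_ _≡_ φ × All (λ e → image φ e LM.∈ edges G) (edges H)

data Reach {m} (G : Hypergraph m) : Fin (nV G) → Fin (nV G) → Set where
  here : ∀ {u} → Reach G u u
  step : ∀ {u w v} (e : Subset (nV G)) → e LM.∈ edges G → u ∈ e → w ∈ e →
         Reach G w v → Reach G u v

Connected : ∀ {m} → Hypergraph m → Set
Connected G = ∀ u v → Reach G u v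

partSet : ∀ {n r} → (Fin n → Fin r) → Fin r → Subset n
partSet part i = tabulate (λ v → does (part v ≟ i))

IsRKHypergraph : ∀ {m} → ℕ → ℕ → Hypergraph m → Set
IsRKHypergraph {m} r k G =
  Σ (Fin (nV G) → Fin r) λ part →
    ((i : Fin r) → ∣ partSet part i ∣ ≤ k) ×
    ((S : Subset r) → ∣ S ∣ ≡ m →
      ∃ λ e → e LM.∈ edges G × ((i : Fin r) → i ∈ S → ∣ e ∩ partSet part i ∣ ≡ 1))

IsDesign : (m r t lam : ℕ) → List (Subset r) → Set
IsDesign m r t lam blocks =
  All (λ B → ∣ B ∣ ≡ t) blocks ×
  ((S : Subset r) → ∣ S ∣ ≡ m → length (filter (λ B → S ⊆? B) blocks) ≡ lam)

DesignExists : ℕ → ℕ → ℕ → ℕ → Set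
DesignExists m r t lam = ∃ λ (blocks : List (Subset r)) → IsDesign m r t lam blocks

-- "f_m(r, 𝓗) ≤ N / D" (over ℚ, D > 0), stated as: there is k with k * D ≤ N and an
-- m-uniform (r,k)-hypergraph containing no member of 𝓗 as a subgraph.
fBoundedBy : (m r : ℕ) → (Hypergraph m → Set) → (N D : ℕ) → Set
fBoundedBy m r 𝓗 N D =
  ∃ λ k → k * D ≤ N ×
    (∃ λ (G : Hypergraph m) → IsRKHypergraph r k G × ((H : Hypergraph m) → 𝓗 H → ¬ (H ⊑ G)))

{-# OPTIONS --safe #-}
module Submission where

-- For every block B of the design take a copy of the complete m-uniform hypergraph on
-- the points of B, and let G be the disjoint union of these copies, the vertex (B, x)
-- being put into the part V_x. Every m-set of points lies in a block, so G is an
-- (r, k)-hypergraph as soon as k bounds the replication numbers (the number of blocks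
-- through a point), and double counting the pairs (S, B) with x ∈ S ⊆ B, |S| = m,
-- bounds these by C(r-1, m-1) / C(t-1, m-1). A connected hypergraph embedded in G
-- stays inside one copy, which has only t vertices.

open import Defs
open import Data.Nat using (ℕ; _≤_; _<_; _∸_)
open import Data.Nat.Combinatorics using (_C_)
open import Data.Product using (_×_)

open import Data.Bool.Base using (Bool; true; false; _∧_)
open import Data.Bool.Properties using (∧-comm; ∧-assoc; ∧-zeroʳ; ∧-identityʳ)
open import Data.Fin.Base using (Fin; zero; suc; fromℕ<)
open import Data.Fin.Properties using (_≟_; 0≢1+n; any?; suc-injective)
open import Data.Fin.Subset using (Subset; inside; outside; ⊤; ⊥; ⁅_⁆; _∩_; _∈_; _⊆_; ∣_∣)
open import Data.Fin.Subset.Properties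
  using (_∈?_; _⊆?_; ∈⊤; drop-∷-⊆; out⊆; in⊆in; ∣⊥∣≡0; ∣⊤∣≡n;
         ∩-assoc; ∩-identityˡ; ∩-identityʳ; ∩-zeroʳ)
open import Data.List.Base as L using (List; []; _∷_; map; _++_; length; filter; filterᵇ)
open import Data.List.Properties using (length-map; length-++; filter-++; ++-identityʳ)
open import Data.List.Membership.Propositional using () renaming (_∈_ to _∈ˡ_)
open import Data.List.Membership.Propositional.Properties
  using (∈-map⁺; ∈-map⁻; ∈-++⁺ˡ; ∈-++⁺ʳ; ∈-++⁻; ∈-concat⁺′; ∈-concat⁻′;
         ∈-tabulate⁺; ∈-tabulate⁻; ∈-lookup; ∈-filter⁻)
open import Data.List.Relation.Unary.All as All using (All)
open import Data.List.Relation.Unary.Any using (here; there; index)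
open import Data.List.Relation.Unary.Any.Properties using (lookup-index)
open import Data.Nat.Base using (zero; suc; _+_; _*_; z≤n; s≤s)
open import Data.Nat.Combinatorics using (nCk+nC[k+1]≡[n+1]C[k+1])
open import Data.Nat.DivMod using (_/_; m/n*n≤m; m*n/n≡m; /-monoˡ-≤)
open import Data.Nat.Properties
  using (+-assoc; +-comm; +-identityʳ; +-mono-≤; *-distribʳ-+; *-identityˡ; *-zeroʳ;
         ≤-reflexive; ≤-trans; m≤n⇒m≤1+n; <⇒≱; +-commutativeSemigroup; module ≤-Reasoning)
open import Algebra.Properties.CommutativeSemigroup +-commutativeSemigroup using (interchange)
open import Data.Product.Base using (_,_; proj₁; proj₂; map₁; ∃; uncurry)
open import Data.Sum.Base using (inj₁; inj₂)
open import Data.Vec.Base using ([]; _∷_; here; there; lookup; tabulate; _[_]≔_)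
open import Data.Vec.Properties
  using (lookup-replicate; lookup-zipWith; lookup∘tabulate; tabulate-cong;
         lookup⇒[]=; []=⇒lookup; []≔-minimal)
open import Function.Base using (_∘_)
open import Function.Consequences.Propositional using (contraInjective)
open import Function.Definitions using (Injective)
open import Relation.Binary.PropositionalEquality
  using (_≡_; refl; sym; trans; cong; cong₂; subst; module ≡-Reasoning)
open import Relation.Nullary using (Dec; yes; no; does; ¬_)
open import Relation.Nullary.Decidable using (dec-true; _×-dec_)
open import Relation.Unary using (Pred; Decidable)

private variable
  A B : Set
  n : ℕ

-- Sums and counts over lists

⟦_⟧ : Bool → ℕ
⟦ true ⟧ = 1
⟦ false ⟧ = 0

∑ : (A → ℕ) → List A → ℕ
∑ f [] = 0
∑ f (x ∷ xs) = f x + ∑ f xs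

count : (A → Bool) → List A → ℕ
count p = ∑ (λ x → ⟦ p x ⟧)

∑-++ : ∀ (f : A → ℕ) xs ys → ∑ f (xs ++ ys) ≡ ∑ f xs + ∑ f ys
∑-++ f [] ys = refl
∑-++ f (x ∷ xs) ys = trans (cong (f x +_) (∑-++ f xs ys)) (sym (+-assoc (f x) _ _))

∑-map : ∀ (f : B → ℕ) (g : A → B) xs → ∑ f (map g xs) ≡ ∑ (f ∘ g) xs
∑-map f g [] = refl
∑-map f g (x ∷ xs) = cong (f (g x) +_) (∑-map f g xs)

∑-cong : ∀ {f g : A → ℕ} xs → (∀ {x} → x ∈ˡ xs → f x ≡ g x) → ∑ f xs ≡ ∑ g xs
∑-cong [] _ = refl
∑-cong (x ∷ xs) f≡g = cong₂ _+_ (f≡g (here refl)) (∑-cong xs (f≡g ∘ there))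

∑-mono-≤ : ∀ {f g : A → ℕ} xs → (∀ {x} → x ∈ˡ xs → f x ≤ g x) → ∑ f xs ≤ ∑ g xs
∑-mono-≤ [] _ = z≤n
∑-mono-≤ (x ∷ xs) f≤g = +-mono-≤ (f≤g (here refl)) (∑-mono-≤ xs (f≤g ∘ there))

∑-zero : ∀ (xs : List A) → ∑ (λ _ → 0) xs ≡ 0
∑-zero [] = refl
∑-zero (x ∷ xs) = ∑-zero xs

∑-+ : ∀ (f g : A → ℕ) xs → ∑ (λ x → f x + g x) xs ≡ ∑ f xs + ∑ g xs
∑-+ f g [] = refl
∑-+ f g (x ∷ xs) = trans (cong (f x + g x +_) (∑-+ f g xs)) (interchange (f x) (g x) _ _)

∑-*ʳ : ∀ (f : A → ℕ) c xs → ∑ (λ x → f x * c) xs ≡ ∑ f xs * c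
∑-*ʳ f c [] = refl
∑-*ʳ f c (x ∷ xs) = trans (cong (f x * c +_) (∑-*ʳ f c xs)) (sym (*-distribʳ-+ c (f x) _))

∑-swap : ∀ (h : A → B → ℕ) xs ys →
         ∑ (λ x → ∑ (h x) ys) xs ≡ ∑ (λ y → ∑ (λ x → h x y) xs) ys
∑-swap h [] ys = sym (∑-zero ys)
∑-swap h (x ∷ xs) ys =
  trans (cong (∑ (h x) ys +_) (∑-swap h xs ys)) (sym (∑-+ (h x) _ ys))

count-true : ∀ (xs : List A) → count (λ _ → true) xs ≡ length xs
count-true [] = refl
count-true (x ∷ xs) = cong suc (count-true xs)

count-≤-length : ∀ (p : A → Bool) xs → count p xs ≤ length xs
count-≤-length p [] = z≤n
count-≤-length p (x ∷ xs) with p x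
... | true = s≤s (count-≤-length p xs)
... | false = m≤n⇒m≤1+n (count-≤-length p xs)

length-filter≡count : ∀ {ℓ} {P : Pred A ℓ} (P? : Decidable P) xs →
                      length (filter P? xs) ≡ count (λ x → does (P? x)) xs
length-filter≡count P? [] = refl
length-filter≡count P? (x ∷ xs) with does (P? x)
... | true = cong suc (length-filter≡count P? xs)
... | false = length-filter≡count P? xs

count-filterᵇ : ∀ (p q : A → Bool) xs → count q (filterᵇ p xs) ≡ count (λ x → p x ∧ q x) xs
count-filterᵇ p q [] = refl
count-filterᵇ p q (x ∷ xs) with p x
... | true = cong (⟦ q x ⟧ +_) (count-filterᵇ p q xs)
... | false = count-filterᵇ p q xs

filterᵇ-map : ∀ (p : B → Bool) (f : A → B) xs → filterᵇ p (map f xs) ≡ map f (filterᵇ (p ∘ f) xs)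
filterᵇ-map p f [] = refl
filterᵇ-map p f (x ∷ xs) with p (f x)
... | true = cong (f x ∷_) (filterᵇ-map p f xs)
... | false = filterᵇ-map p f xs

filterᵇ-map-≡ : ∀ (p : B → Bool) (f : A → B) xs {ys} →
                filterᵇ (p ∘ f) xs ≡ ys → filterᵇ p (map f xs) ≡ map f ys
filterᵇ-map-≡ p f xs eq = trans (filterᵇ-map p f xs) (cong (map f) eq)

length≡1⇒∃∈ : ∀ {xs : List A} → length xs ≡ 1 → ∃ λ x → x ∈ˡ xs
length≡1⇒∃∈ {xs = x ∷ _} _ = x , here refl

filterᵇ-false : ∀ (xs : List A) → filterᵇ (λ _ → false) xs ≡ []
filterᵇ-false [] = refl
filterᵇ-false (x ∷ xs) = filterᵇ-false xs

-- Subsets of Fin n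

∣∷∣ : ∀ b (p : Subset n) → ∣ b ∷ p ∣ ≡ ⟦ b ⟧ + ∣ p ∣
∣∷∣ true p = refl
∣∷∣ false p = refl

∣tabulate∘lookup∣ : ∀ (p : A → Bool) xs → ∣ tabulate (p ∘ L.lookup xs) ∣ ≡ count p xs
∣tabulate∘lookup∣ p [] = refl
∣tabulate∘lookup∣ p (x ∷ xs) =
  trans (∣∷∣ (p x) (tabulate (p ∘ L.lookup xs))) (cong (⟦ p x ⟧ +_) (∣tabulate∘lookup∣ p xs))

tabulate-∩ : ∀ (f g : Fin n → Bool) → tabulate f ∩ tabulate g ≡ tabulate (λ x → f x ∧ g x)
tabulate-∩ {zero} f g = refl
tabulate-∩ {suc n} f g = cong (f zero ∧ g zero ∷_) (tabulate-∩ (f ∘ suc) (g ∘ suc))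

lookup-⁅⁆ : ∀ (x y : Fin n) → lookup ⁅ x ⁆ y ≡ does (y ≟ x)
lookup-⁅⁆ zero zero = refl
lookup-⁅⁆ zero (suc y) = lookup-replicate y outside
lookup-⁅⁆ (suc x) zero = refl
lookup-⁅⁆ (suc x) (suc y) = lookup-⁅⁆ x y

x∈p⇒∣p∣≡1+∣p[x]≔outside∣ : ∀ {x} {p : Subset n} → x ∈ p → ∣ p ∣ ≡ suc ∣ p [ x ]≔ outside ∣
x∈p⇒∣p∣≡1+∣p[x]≔outside∣ here = refl
x∈p⇒∣p∣≡1+∣p[x]≔outside∣ (there {y = inside} x∈p) = cong suc (x∈p⇒∣p∣≡1+∣p[x]≔outside∣ x∈p)
x∈p⇒∣p∣≡1+∣p[x]≔outside∣ (there {y = outside} x∈p) = x∈p⇒∣p∣≡1+∣p[x]≔outside∣ x∈p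

∣p∩⁅x⁆∣≡⟦p[x]⟧ : ∀ (p : Subset n) x → ∣ p ∩ ⁅ x ⁆ ∣ ≡ ⟦ lookup p x ⟧
∣p∩⁅x⁆∣≡⟦p[x]⟧ {suc n} (b ∷ p) zero rewrite ∧-identityʳ b | ∩-zeroʳ p =
  trans (∣∷∣ b (⊥ {n})) (trans (cong (⟦ b ⟧ +_) (∣⊥∣≡0 n)) (+-identityʳ ⟦ b ⟧))
∣p∩⁅x⁆∣≡⟦p[x]⟧ (b ∷ p) (suc x) rewrite ∧-zeroʳ b = ∣p∩⁅x⁆∣≡⟦p[x]⟧ p x

p⊆q⇒q∩p≡p : ∀ {p q : Subset n} → p ⊆ q → q ∩ p ≡ p
p⊆q⇒q∩p≡p {p = []} {[]} _ = refl
p⊆q⇒q∩p≡p {p = outside ∷ p} {b ∷ q} p⊆q rewrite ∧-zeroʳ b = cong (outside ∷_) (p⊆q⇒q∩p≡p (drop-∷-⊆ p⊆q))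
p⊆q⇒q∩p≡p {p = inside ∷ p} {b ∷ q} p⊆q with p⊆q here
... | here = cong (inside ∷_) (p⊆q⇒q∩p≡p (drop-∷-⊆ p⊆q))

injective⇒≤∣p∣ : ∀ {m} {p : Subset n} (f : Fin m → Fin n) → Injective _≡_ _≡_ f →
                 (∀ x → f x ∈ p) → m ≤ ∣ p ∣
injective⇒≤∣p∣ {m = zero} f f-inj f∈p = z≤n
injective⇒≤∣p∣ {m = suc m} {p} f f-inj f∈p =
  ≤-trans (s≤s (injective⇒≤∣p∣ (f ∘ suc) (suc-injective ∘ f-inj) f∘suc∈p′))
          (≤-reflexive (sym (x∈p⇒∣p∣≡1+∣p[x]≔outside∣ (f∈p zero))))
  where
  f∘suc∈p′ : ∀ x → f (suc x) ∈ p [ f zero ]≔ outside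
  f∘suc∈p′ x = []≔-minimal p (f (suc x)) (f zero) (contraInjective f-inj (0≢1+n ∘ sym)) (f∈p (suc x))

-- k-element subsets

_⊆ᵇ_ : Subset n → Subset n → Bool
p ⊆ᵇ q = does (p ⊆? q)

ksubsets : Subset n → ℕ → List (Subset n)
ksubsets [] zero = [] ∷ []
ksubsets [] (suc k) = []
ksubsets (outside ∷ p) k = map (outside ∷_) (ksubsets p k)
ksubsets (inside ∷ p) zero = map (outside ∷_) (ksubsets p zero)
ksubsets (inside ∷ p) (suc k) =
  map (outside ∷_) (ksubsets p (suc k)) ++ map (inside ∷_) (ksubsets p k)

ksubsets-zero : ∀ (p : Subset n) → ksubsets p 0 ≡ ⊥ ∷ []
ksubsets-zero [] = refl
ksubsets-zero (outside ∷ p) = cong (map (outside ∷_)) (ksubsets-zero p)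
ksubsets-zero (inside ∷ p) = cong (map (outside ∷_)) (ksubsets-zero p)

length-ksubsets : ∀ (p : Subset n) k → length (ksubsets p k) ≡ ∣ p ∣ C k
length-ksubsets p zero = trans (cong length (ksubsets-zero p)) (sym (nC0≡1 ∣ p ∣))
  where
  nC0≡1 : ∀ n → n C 0 ≡ 1
  nC0≡1 zero = refl
  nC0≡1 (suc n) = refl
length-ksubsets [] (suc k) = refl
length-ksubsets (outside ∷ p) (suc k) =
  trans (length-map _ (ksubsets p (suc k))) (length-ksubsets p (suc k))
length-ksubsets (inside ∷ p) (suc k) = begin
  length (map (outside ∷_) (ksubsets p (suc k)) ++ map (inside ∷_) (ksubsets p k))
    ≡⟨ length-++ (map (outside ∷_) (ksubsets p (suc k))) ⟩
  length (map (outside ∷_) (ksubsets p (suc k))) + length (map (inside ∷_) (ksubsets p k))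
    ≡⟨ cong₂ _+_ (length-map _ (ksubsets p (suc k))) (length-map _ (ksubsets p k)) ⟩
  length (ksubsets p (suc k)) + length (ksubsets p k)
    ≡⟨ cong₂ _+_ (length-ksubsets p (suc k)) (length-ksubsets p k) ⟩
  ∣ p ∣ C suc k + ∣ p ∣ C k
    ≡⟨ +-comm (∣ p ∣ C suc k) _ ⟩
  ∣ p ∣ C k + ∣ p ∣ C suc k
    ≡⟨ nCk+nC[k+1]≡[n+1]C[k+1] ∣ p ∣ k ⟩
  suc ∣ p ∣ C suc k ∎
  where open ≡-Reasoning

∈-ksubsets⁻ : ∀ (p : Subset n) k {S} → S ∈ˡ ksubsets p k → S ⊆ p × ∣ S ∣ ≡ k
∈-ksubsets⁻-outside : ∀ b (p : Subset n) k {S} → S ∈ˡ map (outside ∷_) (ksubsets p k) →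
                      S ⊆ b ∷ p × ∣ S ∣ ≡ k

∈-ksubsets⁻ [] zero (here refl) = (λ x∈S → x∈S) , refl
∈-ksubsets⁻ (outside ∷ p) k S∈ = ∈-ksubsets⁻-outside outside p k S∈
∈-ksubsets⁻ (inside ∷ p) zero S∈ = ∈-ksubsets⁻-outside inside p zero S∈
∈-ksubsets⁻ (inside ∷ p) (suc k) S∈ with ∈-++⁻ (map (outside ∷_) (ksubsets p (suc k))) S∈
... | inj₁ S∈₁ = ∈-ksubsets⁻-outside inside p (suc k) S∈₁
... | inj₂ S∈₂ with ∈-map⁻ (inside ∷_) S∈₂
...   | S , S∈′ , refl with ∈-ksubsets⁻ p k S∈′
...     | S⊆p , ∣S∣≡k = in⊆in S⊆p , cong suc ∣S∣≡k

∈-ksubsets⁻-outside b p k S∈ with ∈-map⁻ (outside ∷_) S∈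
... | S , S∈′ , refl with ∈-ksubsets⁻ p k S∈′
...   | S⊆p , ∣S∣≡k = out⊆ S⊆p , ∣S∣≡k

∈-ksubsets⁺ : ∀ (p : Subset n) k {S} → S ⊆ p → ∣ S ∣ ≡ k → S ∈ˡ ksubsets p k
∈-ksubsets⁺ [] zero {[]} _ _ = here refl
∈-ksubsets⁺ (outside ∷ p) k {outside ∷ S} S⊆p ∣S∣≡k =
  ∈-map⁺ (outside ∷_) (∈-ksubsets⁺ p k (drop-∷-⊆ S⊆p) ∣S∣≡k)
∈-ksubsets⁺ (inside ∷ p) zero {outside ∷ S} S⊆p ∣S∣≡k =
  ∈-map⁺ (outside ∷_) (∈-ksubsets⁺ p zero (drop-∷-⊆ S⊆p) ∣S∣≡k)
∈-ksubsets⁺ (inside ∷ p) (suc k) {outside ∷ S} S⊆p ∣S∣≡k =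
  ∈-++⁺ˡ (∈-map⁺ (outside ∷_) (∈-ksubsets⁺ p (suc k) (drop-∷-⊆ S⊆p) ∣S∣≡k))
∈-ksubsets⁺ (b ∷ p) (suc k) {inside ∷ S} S⊆p refl with S⊆p here
... | here = ∈-++⁺ʳ (map (outside ∷_) (ksubsets p (suc k)))
                   (∈-map⁺ (inside ∷_) (∈-ksubsets⁺ p k (drop-∷-⊆ S⊆p) refl))

filter-ksubsets : ∀ (p q : Subset n) k →
                  filterᵇ (_⊆ᵇ q) (ksubsets p k) ≡ ksubsets (p ∩ q) k
filter-ksubsets [] [] zero = refl
filter-ksubsets [] [] (suc k) = refl
filter-ksubsets (outside ∷ p) (b ∷ q) k =
  filterᵇ-map-≡ (_⊆ᵇ (b ∷ q)) (outside ∷_) (ksubsets p k) (filter-ksubsets p q k)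
filter-ksubsets (inside ∷ p) (outside ∷ q) zero =
  filterᵇ-map-≡ (_⊆ᵇ (outside ∷ q)) (outside ∷_) (ksubsets p zero) (filter-ksubsets p q zero)
filter-ksubsets (inside ∷ p) (inside ∷ q) zero =
  filterᵇ-map-≡ (_⊆ᵇ (inside ∷ q)) (outside ∷_) (ksubsets p zero) (filter-ksubsets p q zero)
filter-ksubsets (inside ∷ p) (inside ∷ q) (suc k) =
  trans (filter-++ _ (map (outside ∷_) (ksubsets p (suc k))) _)
        (cong₂ _++_ (filterᵇ-map-≡ ⊆q (outside ∷_) (ksubsets p (suc k)) (filter-ksubsets p q (suc k)))
                    (filterᵇ-map-≡ ⊆q (inside ∷_) (ksubsets p k) (filter-ksubsets p q k)))
  where ⊆q = _⊆ᵇ (inside ∷ q)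
filter-ksubsets (inside ∷ p) (outside ∷ q) (suc k) =
  trans (filter-++ _ (map (outside ∷_) (ksubsets p (suc k))) _)
        (trans (cong₂ _++_ (filterᵇ-map-≡ ⊆q (outside ∷_) (ksubsets p (suc k)) (filter-ksubsets p q (suc k)))
                           (filterᵇ-map-≡ ⊆q (inside ∷_) (ksubsets p k) (filterᵇ-false (ksubsets p k))))
               (++-identityʳ _))
  where ⊆q = _⊆ᵇ (outside ∷ q)

count-⊆-ksubsets : ∀ (q : Subset n → Bool) p B k →
  count (λ S → q S ∧ S ⊆ᵇ B) (ksubsets p k) ≡ count q (ksubsets (p ∩ B) k)
count-⊆-ksubsets q p B k = begin
  count (λ S → q S ∧ S ⊆ᵇ B) (ksubsets p k)
    ≡⟨ ∑-cong (ksubsets p k) (λ {S} _ → cong ⟦_⟧ (∧-comm (q S) _)) ⟩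
  count (λ S → S ⊆ᵇ B ∧ q S) (ksubsets p k)
    ≡⟨ count-filterᵇ (_⊆ᵇ B) q (ksubsets p k) ⟨
  count q (filterᵇ (_⊆ᵇ B) (ksubsets p k))
    ≡⟨ cong (count q) (filter-ksubsets p B k) ⟩
  count q (ksubsets (p ∩ B) k) ∎
  where open ≡-Reasoning

∑-ksubsets-inside : ∀ (f : Subset (suc n) → ℕ) p k →
  ∑ f (ksubsets (inside ∷ p) (suc k)) ≡
  ∑ (f ∘ (outside ∷_)) (ksubsets p (suc k)) + ∑ (f ∘ (inside ∷_)) (ksubsets p k)
∑-ksubsets-inside f p k =
  trans (∑-++ f (map (outside ∷_) (ksubsets p (suc k))) _)
        (cong₂ _+_ (∑-map f _ (ksubsets p (suc k))) (∑-map f _ (ksubsets p k)))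

count-∋-ksubsets : ∀ {x} {p : Subset n} k → x ∈ p →
  count (λ S → lookup S x) (ksubsets p (suc k)) ≡ length (ksubsets (p [ x ]≔ outside) k)
count-∋-ksubsets {p = inside ∷ p} k here = begin
  count (λ S → lookup S zero) (ksubsets (inside ∷ p) (suc k))
    ≡⟨ ∑-ksubsets-inside _ p k ⟩
  ∑ (λ _ → 0) (ksubsets p (suc k)) + count (λ _ → true) (ksubsets p k)
    ≡⟨ cong₂ _+_ (∑-zero (ksubsets p (suc k))) (count-true (ksubsets p k)) ⟩
  length (ksubsets p k)
    ≡⟨ length-map (outside ∷_) (ksubsets p k) ⟨
  length (ksubsets (outside ∷ p) k) ∎
  where open ≡-Reasoning
count-∋-ksubsets {p = outside ∷ p} k (there x∈p) =
  trans (∑-map _ _ (ksubsets p (suc k)))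
        (trans (count-∋-ksubsets k x∈p) (sym (length-map (outside ∷_) (ksubsets (p [ _ ]≔ outside) k))))
count-∋-ksubsets {x = suc x} {p = inside ∷ p} zero (there x∈p) = begin
  count (λ S → lookup S (suc x)) (ksubsets (inside ∷ p) 1)
    ≡⟨ ∑-ksubsets-inside _ p zero ⟩
  count (λ S → lookup S x) (ksubsets p 1) + count (λ S → lookup S x) (ksubsets p 0)
    ≡⟨ cong₂ _+_ (count-∋-ksubsets zero x∈p) (cong (count (λ S → lookup S x)) (ksubsets-zero p)) ⟩
  length (ksubsets (p [ x ]≔ outside) 0) + (⟦ lookup ⊥ x ⟧ + 0)
    ≡⟨ cong (λ b → length (ksubsets (p [ x ]≔ outside) 0) + (⟦ b ⟧ + 0)) (lookup-replicate x outside) ⟩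
  length (ksubsets (p [ x ]≔ outside) 0) + 0
    ≡⟨ +-identityʳ _ ⟩
  length (ksubsets (p [ x ]≔ outside) 0)
    ≡⟨ length-map (outside ∷_) (ksubsets (p [ x ]≔ outside) 0) ⟨
  length (ksubsets (inside ∷ p [ x ]≔ outside) 0) ∎
  where open ≡-Reasoning
count-∋-ksubsets {x = suc x} {p = inside ∷ p} (suc k) (there x∈p) = begin
  count (λ S → lookup S (suc x)) (ksubsets (inside ∷ p) (suc (suc k)))
    ≡⟨ ∑-ksubsets-inside _ p (suc k) ⟩
  count (λ S → lookup S x) (ksubsets p (suc (suc k))) + count (λ S → lookup S x) (ksubsets p (suc k))
    ≡⟨ cong₂ _+_ (count-∋-ksubsets (suc k) x∈p) (count-∋-ksubsets k x∈p) ⟩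
  length (ksubsets p′ (suc k)) + length (ksubsets p′ k)
    ≡⟨ cong₂ _+_ (length-map (outside ∷_) (ksubsets p′ (suc k))) (length-map (inside ∷_) (ksubsets p′ k)) ⟨
  length (map (outside ∷_) (ksubsets p′ (suc k))) + length (map (inside ∷_) (ksubsets p′ k))
    ≡⟨ length-++ (map (outside ∷_) (ksubsets p′ (suc k))) ⟨
  length (ksubsets (inside ∷ p′) (suc k)) ∎
  where
  open ≡-Reasoning
  p′ = p [ x ]≔ outside

count-∋-ksubsets-C : ∀ {x} {p : Subset n} k → x ∈ p →
  count (λ S → lookup S x) (ksubsets p (suc k)) ≡ (∣ p ∣ ∸ 1) C k
count-∋-ksubsets-C {x = x} {p} k x∈p =
  trans (count-∋-ksubsets k x∈p)
        (trans (length-ksubsets (p [ x ]≔ outside) k)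
               (sym (cong (λ c → (c ∸ 1) C k) (x∈p⇒∣p∣≡1+∣p[x]≔outside∣ x∈p))))

-- Designs

replication : List (Subset n) → Fin n → ℕ
replication Bs x = count (λ B → lookup B x) Bs

replication-bound : ∀ {r t k} {Bs : List (Subset r)} → IsDesign (suc k) r t 1 Bs →
                    ∀ x → replication Bs x * ((t ∸ 1) C k) ≤ (r ∸ 1) C k
replication-bound {r} {t} {k} {Bs} (∣B∣≡t , unique) x = begin
  replication Bs x * ((t ∸ 1) C k)             ≡⟨ ∑-*ʳ _ _ Bs ⟨
  ∑ (λ B → ⟦ lookup B x ⟧ * ((t ∸ 1) C k)) Bs   ≤⟨ ∑-mono-≤ Bs per-block ⟩
  ∑ (λ B → count (λ S → x∈ S ⊆ B) 𝒮) Bs         ≡⟨ ∑-swap _ 𝒮 Bs ⟨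
  ∑ (λ S → count (x∈ S ⊆_) Bs) 𝒮                 ≡⟨ ∑-cong 𝒮 per-set ⟩
  count (λ S → lookup S x) 𝒮                    ≡⟨ count-∋-ksubsets-C k (∈⊤ {x = x}) ⟩
  (∣ ⊤ {r} ∣ ∸ 1) C k                           ≡⟨ cong (λ c → (c ∸ 1) C k) (∣⊤∣≡n r) ⟩
  (r ∸ 1) C k                                  ∎
  where
  open ≤-Reasoning
  𝒮 = ksubsets ⊤ (suc k)

  x∈_⊆_ : Subset r → Subset r → Bool
  x∈ S ⊆ B = lookup S x ∧ S ⊆ᵇ B

  per-block : ∀ {B} → B ∈ˡ Bs → ⟦ lookup B x ⟧ * ((t ∸ 1) C k) ≤ count (λ S → x∈ S ⊆ B) 𝒮
  per-block {B} B∈ with lookup B x in x∈B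
  ... | false = z≤n
  ... | true = ≤-reflexive (begin-equality
    1 * ((t ∸ 1) C k)
      ≡⟨ *-identityˡ _ ⟩
    (t ∸ 1) C k
      ≡⟨ cong (λ c → (c ∸ 1) C k) (All.lookup ∣B∣≡t B∈) ⟨
    (∣ B ∣ ∸ 1) C k
      ≡⟨ count-∋-ksubsets-C k (lookup⇒[]= x B x∈B) ⟨
    count (λ S → lookup S x) (ksubsets B (suc k))
      ≡⟨ cong (λ p → count (λ S → lookup S x) (ksubsets p (suc k))) (∩-identityˡ B) ⟨
    count (λ S → lookup S x) (ksubsets (⊤ ∩ B) (suc k))
      ≡⟨ count-⊆-ksubsets (λ S → lookup S x) ⊤ B (suc k) ⟨
    count (λ S → x∈ S ⊆ B) 𝒮 ∎)

  per-set : ∀ {S} → S ∈ˡ 𝒮 → count (x∈ S ⊆_) Bs ≡ ⟦ lookup S x ⟧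
  per-set {S} S∈ with lookup S x
  ... | false = ∑-zero Bs
  ... | true = trans (sym (length-filter≡count (S ⊆?_) Bs))
                     (unique S (proj₂ (∈-ksubsets⁻ ⊤ (suc k) S∈)))

design⇒covering : ∀ {m r t} {Bs : List (Subset r)} → IsDesign m r t 1 Bs →
                  ∀ S → ∣ S ∣ ≡ m → ∃ λ B → B ∈ˡ Bs × S ⊆ B
design⇒covering (_ , unique) S ∣S∣≡m =
  let B , B∈ = length≡1⇒∃∈ (unique S ∣S∣≡m) in B , ∈-filter⁻ (S ⊆?_) B∈

-- The disjoint union of block cliques

elements : Subset n → List (Fin n)
elements [] = []
elements (outside ∷ p) = map suc (elements p)
elements (inside ∷ p) = zero ∷ map suc (elements p)

count-elements : ∀ (p q : Subset n) → count (lookup q) (elements p) ≡ ∣ p ∩ q ∣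
count-elements [] [] = refl
count-elements (outside ∷ p) (b ∷ q) = trans (∑-map _ suc (elements p)) (count-elements p q)
count-elements (inside ∷ p) (b ∷ q) =
  trans (cong (⟦ b ⟧ +_) (trans (∑-map _ suc (elements p)) (count-elements p q)))
        (sym (∣∷∣ b (p ∩ q)))

incidences : (Bs : List (Subset n)) → List (Fin (length Bs) × Fin n)
incidences [] = []
incidences (B ∷ Bs) = map (zero ,_) (elements B) ++ map (map₁ suc) (incidences Bs)

count-incidences-∷ : ∀ B (Bs : List (Subset n)) (g : Fin (suc (length Bs)) × Fin n → Bool) →
  count g (incidences (B ∷ Bs)) ≡
  count (g ∘ (zero ,_)) (elements B) + count (g ∘ map₁ suc) (incidences Bs)
count-incidences-∷ B Bs g =
  trans (∑-++ _ (map (zero ,_) (elements B)) _)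
        (cong₂ _+_ (∑-map _ _ (elements B)) (∑-map _ _ (incidences Bs)))

count-incidences-block : ∀ (Bs : List (Subset n)) j q →
  count (λ v → does (proj₁ v ≟ j) ∧ lookup q (proj₂ v)) (incidences Bs) ≡ ∣ L.lookup Bs j ∩ q ∣
count-incidences-block (B ∷ Bs) zero q =
  trans (count-incidences-∷ B Bs _)
        (trans (cong₂ _+_ (count-elements B q) (∑-zero (incidences Bs))) (+-identityʳ _))
count-incidences-block (B ∷ Bs) (suc j) q =
  trans (count-incidences-∷ B Bs _)
        (cong₂ _+_ (∑-zero (elements B)) (count-incidences-block Bs j q))

count-incidences-point : ∀ (Bs : List (Subset n)) q →
  count (λ v → lookup q (proj₂ v)) (incidences Bs) ≡ ∑ (λ B → ∣ B ∩ q ∣) Bs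
count-incidences-point [] q = refl
count-incidences-point (B ∷ Bs) q =
  trans (count-incidences-∷ B Bs _)
        (cong₂ _+_ (count-elements B q) (count-incidences-point Bs q))

Reach⇒≡ : ∀ {m} {C : Set} {H : Hypergraph m} (c : Fin (nV H) → C) →
          (∀ {e} → e ∈ˡ edges H → ∀ {u w} → u ∈ e → w ∈ e → c u ≡ c w) →
          ∀ {u v} → Reach H u v → c u ≡ c v
Reach⇒≡ c monochromatic here = refl
Reach⇒≡ c monochromatic (step e e∈ u∈e w∈e w⇝v) =
  trans (monochromatic e∈ u∈e w∈e) (Reach⇒≡ c monochromatic w⇝v)

∈-image⁺ : ∀ {a b} (f : Fin a → Fin b) {e u} → u ∈ e → f u ∈ image f e
∈-image⁺ f {e} {u} u∈e = lookup⇒[]= (f u) (image f e)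
  (trans (lookup∘tabulate _ (f u))
         (dec-true (any? (λ i → (i ∈? e) ×-dec (f i ≟ f u))) (u , u∈e , refl)))

module BlockCliques {r} (m : ℕ) (Bs : List (Subset r)) where

  nv : ℕ
  nv = length (incidences Bs)

  Vertex : Set
  Vertex = Fin nv

  block : Vertex → Fin (length Bs)
  block v = proj₁ (L.lookup (incidences Bs) v)

  point : Vertex → Fin r
  point v = proj₂ (L.lookup (incidences Bs) v)

  copy : Fin (length Bs) → Subset r → Subset nv
  copy j S = tabulate (λ v → does (block v ≟ j) ∧ lookup S (point v))

  ∣copy∣ : ∀ j S → ∣ copy j S ∣ ≡ ∣ L.lookup Bs j ∩ S ∣
  ∣copy∣ j S = trans (∣tabulate∘lookup∣ _ (incidences Bs)) (count-incidences-block Bs j S)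

  ∣copy∣≡∣S∣ : ∀ {j S} → S ⊆ L.lookup Bs j → ∣ copy j S ∣ ≡ ∣ S ∣
  ∣copy∣≡∣S∣ {j} {S} S⊆B = trans (∣copy∣ j S) (cong ∣_∣ (p⊆q⇒q∩p≡p S⊆B))

  ∈-copy⁻ : ∀ {j S v} → v ∈ copy j S → block v ≡ j
  ∈-copy⁻ {j} {S} {v} v∈ = same-block (block v ≟ j) (trans (sym (lookup∘tabulate _ v)) ([]=⇒lookup v∈))
    where
    same-block : (d : Dec (block v ≡ j)) → does d ∧ lookup S (point v) ≡ true → block v ≡ j
    same-block (yes eq) _ = eq
    same-block (no _) ()

  ∈-copy⁺ : ∀ {j S v} → block v ≡ j → point v ∈ S → v ∈ copy j S
  ∈-copy⁺ {j} {S} {v} eq v∈S = lookup⇒[]= v (copy j S)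
    (trans (lookup∘tabulate _ v) (cong₂ _∧_ (dec-true (block v ≟ j) eq) ([]=⇒lookup v∈S)))

  copy-∩-partSet : ∀ j S x → copy j S ∩ partSet point x ≡ copy j (S ∩ ⁅ x ⁆)
  copy-∩-partSet j S x = trans (tabulate-∩ _ _) (tabulate-cong λ v →
    trans (∧-assoc (does (block v ≟ j)) _ _)
          (cong (does (block v ≟ j) ∧_)
                (sym (trans (lookup-zipWith _∧_ (point v) S ⁅ x ⁆)
                            (cong (lookup S (point v) ∧_) (lookup-⁅⁆ x (point v)))))))

  ∣partSet∣ : ∀ x → ∣ partSet point x ∣ ≡ replication Bs x
  ∣partSet∣ x = begin
    ∣ partSet point x ∣
      ≡⟨ ∣tabulate∘lookup∣ _ (incidences Bs) ⟩
    count (λ v → does (proj₂ v ≟ x)) (incidences Bs)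
      ≡⟨ ∑-cong (incidences Bs) (λ {v} _ → cong ⟦_⟧ (lookup-⁅⁆ x (proj₂ v))) ⟨
    count (λ v → lookup ⁅ x ⁆ (proj₂ v)) (incidences Bs)
      ≡⟨ count-incidences-point Bs ⁅ x ⁆ ⟩
    ∑ (λ B → ∣ B ∩ ⁅ x ⁆ ∣) Bs
      ≡⟨ ∑-cong Bs (λ {B} _ → ∣p∩⁅x⁆∣≡⟦p[x]⟧ B x) ⟩
    replication Bs x ∎
    where open ≡-Reasoning

  copiesOf : Fin (length Bs) → List (Subset nv)
  copiesOf j = map (copy j) (ksubsets (L.lookup Bs j) m)

  copies : List (Subset nv)
  copies = L.concat (L.tabulate copiesOf)

  ∈-copies⁻ : ∀ {e} → e ∈ˡ copies → ∃ λ j → ∃ λ S → S ∈ˡ ksubsets (L.lookup Bs j) m × e ≡ copy j S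
  ∈-copies⁻ e∈ with ∈-concat⁻′ (L.tabulate copiesOf) e∈
  ... | es , e∈es , es∈ with ∈-tabulate⁻ {f = copiesOf} es∈
  ...   | j , refl with ∈-map⁻ (copy j) e∈es
  ...     | S , S∈ , e≡ = j , S , S∈ , e≡

  ∈-copies⁺ : ∀ {j S} → S ∈ˡ ksubsets (L.lookup Bs j) m → copy j S ∈ˡ copies
  ∈-copies⁺ {j} S∈ = ∈-concat⁺′ (∈-map⁺ (copy j) S∈) (∈-tabulate⁺ {f = copiesOf} j)

  G : Hypergraph m
  G = hypergraph nv copies (All.tabulate copies-uniform)
    where
    copies-uniform : ∀ {e} → e ∈ˡ copies → ∣ e ∣ ≡ m
    copies-uniform e∈ with ∈-copies⁻ e∈
    ... | j , S , S∈ , refl with ∈-ksubsets⁻ _ m S∈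
    ...   | S⊆B , ∣S∣≡m = trans (∣copy∣≡∣S∣ S⊆B) ∣S∣≡m

  is-rk : ∀ {k} → (∀ S → ∣ S ∣ ≡ m → ∃ λ B → B ∈ˡ Bs × S ⊆ B) →
          (∀ x → replication Bs x ≤ k) → IsRKHypergraph r k G
  is-rk {k} covering replication≤k =
    point , (λ x → subst (_≤ k) (sym (∣partSet∣ x)) (replication≤k x)) , transversal
    where
    transversal : ∀ S → ∣ S ∣ ≡ m →
                  ∃ λ e → e ∈ˡ copies × (∀ x → x ∈ S → ∣ e ∩ partSet point x ∣ ≡ 1)
    transversal S ∣S∣≡m with covering S ∣S∣≡m
    ... | B , B∈ , S⊆B = copy j S , ∈-copies⁺ (∈-ksubsets⁺ _ m S⊆Bⱼ ∣S∣≡m) , meets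
      where
      j = index B∈
      S⊆Bⱼ : S ⊆ L.lookup Bs j
      S⊆Bⱼ = subst (S ⊆_) (lookup-index B∈) S⊆B
      meets : ∀ x → x ∈ S → ∣ copy j S ∩ partSet point x ∣ ≡ 1
      meets x x∈S = begin
        ∣ copy j S ∩ partSet point x ∣    ≡⟨ cong ∣_∣ (copy-∩-partSet j S x) ⟩
        ∣ copy j (S ∩ ⁅ x ⁆) ∣            ≡⟨ ∣copy∣ j _ ⟩
        ∣ L.lookup Bs j ∩ (S ∩ ⁅ x ⁆) ∣   ≡⟨ cong ∣_∣ (∩-assoc (L.lookup Bs j) S ⁅ x ⁆) ⟨
        ∣ (L.lookup Bs j ∩ S) ∩ ⁅ x ⁆ ∣   ≡⟨ cong (λ p → ∣ p ∩ ⁅ x ⁆ ∣) (p⊆q⇒q∩p≡p S⊆Bⱼ) ⟩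
        ∣ S ∩ ⁅ x ⁆ ∣                     ≡⟨ ∣p∩⁅x⁆∣≡⟦p[x]⟧ S x ⟩
        ⟦ lookup S x ⟧                    ≡⟨ cong ⟦_⟧ ([]=⇒lookup x∈S) ⟩
        1                                 ∎
        where open ≡-Reasoning

  H-free : ∀ {t} → All (λ B → ∣ B ∣ ≤ t) Bs →
           (H : Hypergraph m) → Connected H → t < nV H → ¬ (H ⊑ G)
  H-free {t} ∣B∣≤t H connected t<∣H∣ (φ , φ-injective , φ-edges) = <⇒≱ t<∣H∣ (begin
    nV H                    ≤⟨ injective⇒≤∣p∣ φ φ-injective (λ u → ∈-copy⁺ (same-block u) ∈⊤) ⟩
    ∣ copy j₀ ⊤ ∣            ≡⟨ ∣copy∣ j₀ ⊤ ⟩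
    ∣ L.lookup Bs j₀ ∩ ⊤ ∣   ≡⟨ cong ∣_∣ (∩-identityʳ (L.lookup Bs j₀)) ⟩
    ∣ L.lookup Bs j₀ ∣       ≤⟨ All.lookup ∣B∣≤t (∈-lookup j₀) ⟩
    t                       ∎)
    where
    open ≤-Reasoning
    j₀ = block (φ (fromℕ< t<∣H∣))

    edge-in-one-copy : ∀ {e} → e ∈ˡ edges H → ∀ {u w} → u ∈ e → w ∈ e → block (φ u) ≡ block (φ w)
    edge-in-one-copy e∈ u∈e w∈e with ∈-copies⁻ (All.lookup φ-edges e∈)
    ... | j , S , _ , φe≡ =
      trans (∈-copy⁻ {S = S} (subst (_ ∈_) φe≡ (∈-image⁺ φ u∈e)))
            (sym (∈-copy⁻ {S = S} (subst (_ ∈_) φe≡ (∈-image⁺ φ w∈e))))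

    same-block : ∀ u → block (φ u) ≡ j₀
    same-block u = Reach⇒≡ (block ∘ φ) edge-in-one-copy (connected u _)

∃-common-bound : ∀ {I : Set} (d : I → ℕ) {c} N D → (∀ i → d i ≤ c) → (∀ i → d i * D ≤ N) →
                 ∃ λ k → k * D ≤ N × ∀ i → d i ≤ k
∃-common-bound d {c} N zero d≤c _ = c , subst (_≤ N) (sym (*-zeroʳ c)) z≤n , d≤c
∃-common-bound d N D@(suc _) _ dD≤N =
  N / D , m/n*n≤m N D , λ i → subst (_≤ N / D) (m*n/n≡m (d i) D) (/-monoˡ-≤ D (dD≤N i))

proposition4p1 : (m r t : ℕ) → 2 ≤ m → 1 ≤ r → 1 ≤ t →
    (𝓗 : Hypergraph m → Set) →
    ((H : Hypergraph m) → 𝓗 H → Connected H × t < nV H) →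
    DesignExists m r t 1 →
    fBoundedBy m r 𝓗 ((r ∸ 1) C (m ∸ 1)) ((t ∸ 1) C (m ∸ 1))
proposition4p1 (suc m) r t (s≤s _) _ _ 𝓗 𝓗-large (Bs , design)
  with ∃-common-bound (replication Bs) _ _ (λ _ → count-≤-length _ Bs) (replication-bound design)
... | k , kD≤N , replication≤k =
  k , kD≤N , G , is-rk (design⇒covering design) replication≤k ,
  λ H H∈𝓗 → uncurry (H-free (All.map ≤-reflexive (proj₁ design)) H) (𝓗-large H H∈𝓗)
  where open BlockCliques (suc m) Bs
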